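{- According to relative interval analysis, $l(\mathrm{Nai},\mathrm{Maj})=[-\frac14,\frac14]$, i.e., $\mathrm{Min}(\mathrm{Nai},\mathrm{Maj})=-\frac14$ and $\mathrm{Max}(\mathrm{Nai},\mathrm{Maj})=\frac14$.
   Context: Online frequent items problem: an input sequence is $I=a_1,\ldots,a_n$ of items from an infinite universe, $n=|I|$. An algorithm maintains a buffer holding one item; $s_t$ is the buffer content after step $t$; at step $1$ the buffer receives $a_1$, and at each later step $t$ the algorithm either keeps $s_{t-1}$ or replaces it by $a_t$. With $f_I(a)=|\{i:a_i=a\}|/n$, the aggregate frequency of $\mathcal A$ on $I$ is $\mathcal A(I)=\sum_{t=1}^n f_I(s^{\mathcal A}_t)$. Nai sets $s_t=a_t$ for all $t$. Maj keeps a counter, initially $0$: when an item arrives, if the counter is $0$ it buffers the item and sets the counter to $1$; otherwise, if the arriving item equals the buffered item the counter is incremented, else it is decremented (buffer unchanged). Relative interval analysis: $\mathrm{Min}_{\mathcal A,\mathcal B}(n)=\min_{|I|=n}\{\mathcal A(I)-\mathcal B(I)\}$, $\mathrm{Max}_{\mathcal A,\mathcal B}(n)=\max_{|I|=n}\{\mathcal A(I)-\mathcal B(I)\}$, $\mathrm{Min}(\mathcal A,\mathcal B)=\liminf_{n\to\infty}\mathrm{Min}_{\mathcal A,\mathcal B}(n)/n$, $\mathrm{Max}(\mathcal A,\mathcal B)=\limsup_{n\to\infty}\mathrm{Max}_{\mathcal A,\mathcal B}(n)/n$, and $l(\mathcal A,\mathcal B)=[\mathrm{Min}(\mathcal A,\mathcal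 B),\mathrm{Max}(\mathcal A,\mathcal B)]$. -}

module Defs where

open import Data.Nat as ℕ using (ℕ; zero; suc; _≡ᵇ_)
open import Data.Integer using (+_)
open import Data.Rational using (ℚ; 0ℚ; _+_; _-_; _*_; _/_; -_; _<_; _≤_)
open import Data.List using (List; []; _∷_; length; map; foldr)
open import Data.Bool using (if_then_else_)
open import Data.Product using (Σ; _×_; ∃; ∃-syntax)
open import Relation.Binary.PropositionalEquality using (_≡_)

-- Items come from an infinite universe; we take ℕ.
Item : Set
Item = ℕ

count : Item → List Item → ℕ
count a []       = 0
count a (x ∷ xs) = if x ≡ᵇ a then suc (count a xs) else count a xs

-- q / n  as a rational (n ≥ 1); set to 0 for n = 0 (never relevant)
_÷ℕ_ : ℚ → ℕ → ℚ
q ÷ℕ zero  = 0ℚ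
q ÷ℕ suc k = q * (+ 1 / suc k)

freq : List Item → Item → ℚ
freq I a = (+ count a I / 1) ÷ℕ length I

sumℚ : List ℚ → ℚ
sumℚ = foldr _+_ 0ℚ

-- An online algorithm is represented by the list of its buffer contents s_1 … s_n.
Algorithm : Set
Algorithm = List Item → List Item

Nai : Algorithm
Nai I = I

-- Maj: buffer b, counter c (initially 0; initial buffer content irrelevant)
majGo : Item → ℕ → List Item → List Item
majGo b c       []       = []
majGo b zero    (x ∷ xs) = x ∷ majGo x 1 xs
majGo b (suc c) (x ∷ xs) =
  if x ≡ᵇ b then b ∷ majGo b (suc (suc c)) xs
            else b ∷ majGo b c xs

Maj : Algorithm
Maj I = majGo 0 0 I

agg : Algorithm → List Item → ℚ
agg A I = sumℚ (map (freq I) (A I))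

diff : Algorithm → Algorithm → List Item → ℚ
diff A B I = agg A I - agg B I

IsMinDiff : Algorithm → Algorithm → ℕ → ℚ → Set
IsMinDiff A B n m =
  (∃[ I ] (length I ≡ n × diff A B I ≡ m)) × (∀ I → length I ≡ n → m ≤ diff A B I)

IsMaxDiff : Algorithm → Algorithm → ℕ → ℚ → Set
IsMaxDiff A B n m =
  (∃[ I ] (length I ≡ n × diff A B I ≡ m)) × (∀ I → length I ≡ n → diff A B I ≤ m)

LimInfIs : (ℕ → ℚ) → ℚ → Set
LimInfIs a L = ∀ (ε : ℚ) → 0ℚ < ε →
  (∃[ N ] (∀ n → N ℕ.≤ n → L - ε < a n)) × (∀ N → ∃[ n ] (N ℕ.≤ n × a n < L + ε))

LimSupIs : (ℕ → ℚ) → ℚ → Set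
LimSupIs a L = ∀ (ε : ℚ) → 0ℚ < ε →
  (∃[ N ] (∀ n → N ℕ.≤ n → a n < L + ε)) × (∀ N → ∃[ n ] (N ℕ.≤ n × L - ε < a n))

MinIs : Algorithm → Algorithm → ℚ → Set
MinIs A B L = Σ (ℕ → ℚ) λ m → ((∀ n → 1 ℕ.≤ n → IsMinDiff A B n (m n)) × LimInfIs (λ n → m n ÷ℕ n) L)

MaxIs : Algorithm → Algorithm → ℚ → Set
MaxIs A B L = Σ (ℕ → ℚ) λ m → ((∀ n → 1 ℕ.≤ n → IsMaxDiff A B n (m n)) × LimSupIs (λ n → m n ÷ℕ n) L)

module Submission where

open import Defs
open import Data.Integer using (+_)
open import Data.Rational using (_/_; -_)
open import Data.Product using (_×_)

-- Scale everything by the input length n = k + 1 and write c a for the number of occurrences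
-- of a.  Then n · Nai(I) = Σ_t c(a_t) = Σ_a (c a)², while n · Maj(I) = Σ_t c(s_t).
--
-- Maj above Nai: if M is the largest count, any buffer sequence scores at most n M, whereas
-- Σ_t c(a_t) ≥ M² + (n − M); the difference (M − 1)(n − M) is a product of two naturals with
-- sum k, hence at most ⌊k/2⌋⌈k/2⌉.
--
-- Nai above Maj: Maj and Nai differ only at the D steps where the counter is decremented.
-- Each decrement cancels two different items, so c a + D ≤ n for every a; with K = k − D every
-- count is at most K + 1, so each decrement step loses at most K, and again D K ≤ ⌊k/2⌋⌈k/2⌉.
--
-- Both bounds are attained (a run of ⌊k/2⌋ + 1 equal items followed by distinct ones; distinct
-- items alternating with one fixed item, followed by a run of it).  Hence
-- Max(n) = ⌊k/2⌋⌈k/2⌉ / n = − Min(n), and ⌊k/2⌋⌈k/2⌉ / n² tends to 1/4 from below.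

module Counting where

  open import Data.Nat
  open import Data.Nat.Properties
  open import Data.Nat.Tactic.RingSolver using (solve-∀)
  open import Data.Nat.ListAction using (sum)
  open import Data.Nat.ListAction.Properties using (sum-++)
  open import Algebra.Properties.CommutativeSemigroup +-commutativeSemigroup using (interchange)
  open import Data.Bool using (true; false; T; if_then_else_)
  open import Data.Unit using (tt)
  open import Data.Empty using (⊥-elim)
  open import Data.Sum using (inj₁; inj₂)
  open import Data.Product using (_,_; proj₁; proj₂; ∃-syntax)
  open import Data.List using (List; []; _∷_; _++_; length; map; replicate)
  open import Data.List.Properties using (map-++; length-++; length-++-sucʳ; length-replicate; ++-identityʳ)
  open import Data.List.Extrema.Nat using (argmax; f[⊥]≤f[argmax]; f[xs]≤f[argmax])
  open import Data.List.Relation.Unary.All as All using (All; []; _∷_)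
  open import Data.List.Relation.Unary.Any using (here; there)
  open import Data.List.Membership.Propositional using (_∈_)
  open import Relation.Nullary using (yes; no)
  open import Relation.Binary.PropositionalEquality

  -- Quarter squares

  quarterSquare : ℕ → ℕ
  quarterSquare n = ⌊ n /2⌋ * ⌈ n /2⌉

  ⌈n/2⌉≤1+⌊n/2⌋ : ∀ n → ⌈ n /2⌉ ≤ suc ⌊ n /2⌋
  ⌈n/2⌉≤1+⌊n/2⌋ n = ⌊n/2⌋-mono (n≤1+n (suc n))

  quarterSquare-n+n : ∀ n → quarterSquare (n + n) ≡ n * n
  quarterSquare-n+n n = sym (cong₂ _*_ (n≡⌊n+n/2⌋ n) (n≡⌈n+n/2⌉ n))

  4*quarterSquare≤n*[1+n] : ∀ n → 4 * quarterSquare n ≤ n * suc n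
  4*quarterSquare≤n*[1+n] n = begin
    4 * (l * h)         ≡⟨ regroup l h ⟩
    (l + l) * (h + h)   ≤⟨ *-mono-≤ l+l≤n h+h≤1+n ⟩
    n * suc n           ∎
    where
    open ≤-Reasoning
    l h : ℕ
    l = ⌊ n /2⌋
    h = ⌈ n /2⌉
    regroup : ∀ l h → 4 * (l * h) ≡ (l + l) * (h + h)
    regroup = solve-∀
    l+l≤n : l + l ≤ n
    l+l≤n = ≤-trans (+-monoʳ-≤ l (⌊n/2⌋≤⌈n/2⌉ n)) (≤-reflexive (⌊n/2⌋+⌈n/2⌉≡n n))
    h+h≤1+n : h + h ≤ suc n
    h+h≤1+n = ≤-trans (+-monoˡ-≤ h (⌈n/2⌉≤1+⌊n/2⌋ n)) (≤-reflexive (cong suc (⌊n/2⌋+⌈n/2⌉≡n n)))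

  m≤n⇒m*n≤quarterSquare[m+n] : ∀ {m n} → m ≤ n → m * n ≤ quarterSquare (m + n)
  m≤n⇒m*n≤quarterSquare[m+n] {m} {n} m≤n = begin
    m * n            ≡⟨ cong (m *_) n≡d+h ⟩
    m * (d + h)      ≡⟨ *-distribˡ-+ m d h ⟩
    m * d + m * h    ≡⟨ cong (_+ m * h) (*-comm m d) ⟩
    d * m + m * h    ≤⟨ +-monoˡ-≤ (m * h) (*-monoʳ-≤ d m≤h) ⟩
    d * h + m * h    ≡⟨ +-comm (d * h) (m * h) ⟩
    m * h + d * h    ≡⟨ sym (*-distribʳ-+ h m d) ⟩
    (m + d) * h      ≡⟨ cong (_* h) m+d≡l ⟩
    l * h            ∎
    where
    open ≤-Reasoning
    l h : ℕ
    l = ⌊ m + n /2⌋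
    h = ⌈ m + n /2⌉
    m≤l : m ≤ l
    m≤l = ≤-trans (≤-reflexive (n≡⌊n+n/2⌋ m)) (⌊n/2⌋-mono (+-monoʳ-≤ m m≤n))
    m≤h : m ≤ h
    m≤h = ≤-trans m≤l (⌊n/2⌋≤⌈n/2⌉ (m + n))
    d : ℕ
    d = proj₁ (m≤n⇒∃[o]m+o≡n m≤l)
    m+d≡l : m + d ≡ l
    m+d≡l = proj₂ (m≤n⇒∃[o]m+o≡n m≤l)
    n≡d+h : n ≡ d + h
    n≡d+h = +-cancelˡ-≡ m n (d + h) (begin-equality
      m + n        ≡⟨ sym (⌊n/2⌋+⌈n/2⌉≡n (m + n)) ⟩
      l + h        ≡⟨ cong (_+ h) (sym m+d≡l) ⟩
      m + d + h    ≡⟨ +-assoc m d h ⟩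
      m + (d + h)  ∎)

  m*n≤quarterSquare[m+n] : ∀ m n → m * n ≤ quarterSquare (m + n)
  m*n≤quarterSquare[m+n] m n with ≤-total m n
  ... | inj₁ m≤n = m≤n⇒m*n≤quarterSquare[m+n] m≤n
  ... | inj₂ n≤m = subst₂ _≤_ (*-comm n m) (cong quarterSquare (+-comm n m)) (m≤n⇒m*n≤quarterSquare[m+n] n≤m)

  excess≤quarterSquare : ∀ {S T M k} → 1 ≤ M → M ≤ suc k → S ≤ suc k * M → M * M + suc k ≤ T + M →
                         S ≤ T + quarterSquare k
  excess≤quarterSquare {S} {T} {suc m} (s≤s z≤n) M≤1+k S≤[1+k]M lower with m≤n⇒∃[o]m+o≡n (≤-pred M≤1+k)
  ... | r , refl = begin
    S                                ≤⟨ S≤[1+k]M ⟩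
    suc (m + r) * suc m              ≡⟨ expand m r ⟩
    (suc m * suc m + r) + m * r      ≤⟨ +-mono-≤ square+r≤T (m*n≤quarterSquare[m+n] m r) ⟩
    T + quarterSquare (m + r)        ∎
    where
    open ≤-Reasoning
    expand : ∀ m r → suc (m + r) * suc m ≡ (suc m * suc m + r) + m * r
    expand = solve-∀
    regroup : ∀ m r → suc m * suc m + r + suc m ≡ suc m * suc m + suc (m + r)
    regroup = solve-∀
    square+r≤T : suc m * suc m + r ≤ T
    square+r≤T = +-cancelʳ-≤ (suc m) _ _ (≤-trans (≤-reflexive (regroup m r)) lower)

  -- Counts and weights

  ≡ᵇ-true⇒≡ : ∀ {m n} → (m ≡ᵇ n) ≡ true → m ≡ n
  ≡ᵇ-true⇒≡ {m} {n} eq = ≡ᵇ⇒≡ m n (subst T (sym eq) tt)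

  ≡ᵇ-false⇒≢ : ∀ {m n} → (m ≡ᵇ n) ≡ false → m ≢ n
  ≡ᵇ-false⇒≢ {m} eq refl = subst T eq (≡⇒≡ᵇ m m refl)

  count-here : ∀ a xs → count a (a ∷ xs) ≡ suc (count a xs)
  count-here a xs with a ≡ᵇ a in eq
  ... | true  = refl
  ... | false = ⊥-elim (≡ᵇ-false⇒≢ {a} eq refl)

  count-there : ∀ {x a} xs → x ≢ a → count a (x ∷ xs) ≡ count a xs
  count-there {x} {a} xs x≢a with x ≡ᵇ a in eq
  ... | true  = ⊥-elim (x≢a (≡ᵇ-true⇒≡ eq))
  ... | false = refl

  count-++ : ∀ a xs ys → count a (xs ++ ys) ≡ count a xs + count a ys
  count-++ a []       ys = refl
  count-++ a (x ∷ xs) ys with x ≡ᵇ a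
  ... | true  = cong suc (count-++ a xs ys)
  ... | false = count-++ a xs ys

  count-++-∷ : ∀ a ys x zs → count a (ys ++ x ∷ zs) ≡ count a (x ∷ ys ++ zs)
  count-++-∷ a []       x zs = refl
  count-++-∷ a (y ∷ ys) x zs with y ≡ᵇ a | x ≡ᵇ a | count-++-∷ a ys x zs
  ... | true  | true  | ih = cong suc ih
  ... | true  | false | ih = cong suc ih
  ... | false | true  | ih = ih
  ... | false | false | ih = ih

  count-∷≤ : ∀ a x xs → count a (x ∷ xs) ≤ suc (count a xs)
  count-∷≤ a x xs with x ≡ᵇ a
  ... | true  = ≤-refl
  ... | false = n≤1+n _

  count≤length : ∀ a xs → count a xs ≤ length xs
  count≤length a []       = z≤n
  count≤length a (x ∷ xs) = ≤-trans (count-∷≤ a x xs) (s≤s (count≤length a xs))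

  count-replicate : ∀ a r → count a (replicate r a) ≡ r
  count-replicate a zero    = refl
  count-replicate a (suc r) = trans (count-here a (replicate r a)) (cong suc (count-replicate a r))

  count-replicate-≢ : ∀ {b a} r → b ≢ a → count a (replicate r b) ≡ 0
  count-replicate-≢ zero    b≢a = refl
  count-replicate-≢ (suc r) b≢a = trans (count-there (replicate r _) b≢a) (count-replicate-≢ r b≢a)

  ∈⇒1≤count : ∀ {a xs} → a ∈ xs → 1 ≤ count a xs
  ∈⇒1≤count {a} {_ ∷ xs} (here refl) = ≤-trans (s≤s z≤n) (≤-reflexive (sym (count-here a xs)))
  ∈⇒1≤count {a} {x ∷ xs} (there a∈xs) with x ≡ᵇ a
  ... | true  = ≤-trans (∈⇒1≤count a∈xs) (n≤1+n _)
  ... | false = ∈⇒1≤count a∈xs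

  1≤count⇒∈ : ∀ {a} xs → 1 ≤ count a xs → a ∈ xs
  1≤count⇒∈ {a} (x ∷ xs) 1≤count with x ≡ᵇ a in eq
  ... | true  = here (sym (≡ᵇ-true⇒≡ eq))
  ... | false = there (1≤count⇒∈ xs 1≤count)

  count-pair≤ : ∀ {b x} a ys zs → b ≢ x → count a (b ∷ ys ++ x ∷ zs) ≤ suc (count a (ys ++ zs))
  count-pair≤ {b} {x} a ys zs b≢x with b ≡ᵇ a in b≡a
  ... | true  = s≤s (≤-reflexive (trans (count-++-∷ a ys x zs) (count-there (ys ++ zs) x≢a)))
    where
    x≢a : x ≢ a
    x≢a x≡a = b≢x (trans (≡ᵇ-true⇒≡ b≡a) (sym x≡a))
  ... | false = ≤-trans (≤-reflexive (count-++-∷ a ys x zs)) (count-∷≤ a x (ys ++ zs))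

  mult : List Item → Item → ℕ
  mult I a = count a I

  weight : (Item → ℕ) → List Item → ℕ
  weight w L = sum (map w L)

  -- n times the aggregate frequency of A on an input I of length n
  totalCount : Algorithm → List Item → ℕ
  totalCount A I = weight (mult I) (A I)

  weight-++ : ∀ w L L′ → weight w (L ++ L′) ≡ weight w L + weight w L′
  weight-++ w L L′ = trans (cong sum (map-++ w L L′)) (sum-++ (map w L) (map w L′))

  weight-replicate : ∀ w r a → weight w (replicate r a) ≡ r * w a
  weight-replicate w zero    a = refl
  weight-replicate w (suc r) a = cong (λ v → w a + v) (weight-replicate w r a)

  weight≤length* : ∀ {w M} L → All (λ y → w y ≤ M) L → weight w L ≤ length L * M
  weight≤length* []      []         = z≤n
  weight≤length* (x ∷ L) (wx≤M ∷ h) = +-mono-≤ wx≤M (weight≤length* L h)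

  count*+length≤weight+count : ∀ w a L → All (λ y → 1 ≤ w y) L →
                               count a L * w a + length L ≤ weight w L + count a L
  count*+length≤weight+count w a []      []          = z≤n
  count*+length≤weight+count w a (x ∷ L) (1≤wx ∷ h) with x ≡ᵇ a in eq
  ... | true = begin
    suc c * w a + suc (length L)         ≡⟨ shuffle (w a) c (length L) ⟩
    w a + (c * w a + length L) + 1       ≤⟨ +-monoˡ-≤ 1 (+-monoʳ-≤ (w a) ih) ⟩
    w a + (weight w L + c) + 1           ≡⟨ unshuffle (w a) (weight w L) c ⟩
    w a + weight w L + suc c             ≡⟨ cong (λ v → w v + weight w L + suc c) (sym (≡ᵇ-true⇒≡ eq)) ⟩
    w x + weight w L + suc c             ∎
    where
    open ≤-Reasoning
    c : ℕ
    c = count a L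
    ih : c * w a + length L ≤ weight w L + c
    ih = count*+length≤weight+count w a L h
    shuffle : ∀ v c n → suc c * v + suc n ≡ v + (c * v + n) + 1
    shuffle = solve-∀
    unshuffle : ∀ v s c → v + (s + c) + 1 ≡ v + s + suc c
    unshuffle = solve-∀
  ... | false = begin
    count a L * w a + suc (length L)     ≡⟨ +-suc _ (length L) ⟩
    1 + (count a L * w a + length L)     ≤⟨ +-mono-≤ 1≤wx (count*+length≤weight+count w a L h) ⟩
    w x + (weight w L + count a L)       ≡⟨ sym (+-assoc (w x) (weight w L) (count a L)) ⟩
    w x + weight w L + count a L         ∎
    where open ≤-Reasoning

  mult-positive : ∀ I → All (λ y → 1 ≤ mult I y) I
  mult-positive I = All.tabulate ∈⇒1≤count

  weight≤Nai+quarterSquare : ∀ {k} I L → length I ≡ suc k → length L ≡ suc k →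
                             weight (mult I) L ≤ totalCount Nai I + quarterSquare k
  weight≤Nai+quarterSquare {k} I@(x ∷ xs) L refl |L| =
    excess≤quarterSquare 1≤M (count≤length (argmax w x xs) I) upper lower
    where
    w : Item → ℕ
    w = mult I
    M : ℕ
    M = w (argmax w x xs)
    maximal : All (λ y → w y ≤ M) I
    maximal = f[⊥]≤f[argmax] {f = w} x xs ∷ f[xs]≤f[argmax] {f = w} x xs
    w≤M : ∀ a → w a ≤ M
    w≤M a with 1 ≤? w a
    ... | yes 1≤wa = All.lookup maximal (1≤count⇒∈ I 1≤wa)
    ... | no  1≰wa = subst (_≤ M) (sym (n<1⇒n≡0 (≰⇒> 1≰wa))) z≤n
    1≤M : 1 ≤ M
    1≤M = ≤-trans (∈⇒1≤count {xs = I} (here refl)) (w≤M x)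
    upper : weight w L ≤ length I * M
    upper = subst (λ n → weight w L ≤ n * M) |L| (weight≤length* L (All.tabulate λ {a} _ → w≤M a))
    lower : M * M + length I ≤ weight w I + M
    lower = count*+length≤weight+count w (argmax w x xs) I (mult-positive I)

  length-majGo : ∀ b c xs → length (majGo b c xs) ≡ length xs
  length-majGo b c       []       = refl
  length-majGo b zero    (x ∷ xs) = cong suc (length-majGo x 1 xs)
  length-majGo b (suc c) (x ∷ xs) with x ≡ᵇ b
  ... | true  = cong suc (length-majGo b (suc (suc c)) xs)
  ... | false = cong suc (length-majGo b c xs)

  Maj≤Nai+quarterSquare : ∀ {k} I → length I ≡ suc k → totalCount Maj I ≤ totalCount Nai I + quarterSquare k
  Maj≤Nai+quarterSquare I |I| = weight≤Nai+quarterSquare I (Maj I) |I| (trans (length-majGo 0 0 I) |I|)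

  -- Decrements of the majority counter

  decrements : Item → ℕ → List Item → ℕ
  decrements b c       []       = 0
  decrements b zero    (x ∷ xs) = decrements x 1 xs
  decrements b (suc c) (x ∷ xs) =
    if x ≡ᵇ b then decrements b (suc (suc c)) xs else suc (decrements b c xs)

  replicate-++-∷ : ∀ c (b : Item) xs → replicate c b ++ b ∷ xs ≡ b ∷ replicate c b ++ xs
  replicate-++-∷ zero    b xs = refl
  replicate-++-∷ (suc c) b xs = cong (b ∷_) (replicate-++-∷ c b xs)

  -- replicate c b ++ xs is the multiset of items not cancelled yet: the c copies of b held by
  -- the counter and the remaining input.  A decrement removes two different items from it.
  count+decrements≤length : ∀ a b c xs →
    count a (replicate c b ++ xs) + decrements b c xs ≤ length (replicate c b ++ xs)
  count+decrements≤length a b c       []       =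
    ≤-trans (≤-reflexive (+-identityʳ _)) (count≤length a (replicate c b ++ []))
  count+decrements≤length a b zero    (x ∷ xs) = count+decrements≤length a x 1 xs
  count+decrements≤length a b (suc c) (x ∷ xs) with x ≡ᵇ b in eq
  ... | true = subst (λ L → count a (b ∷ L) + decrements b (suc (suc c)) xs ≤ length (b ∷ L))
                     (sym pending≡) (count+decrements≤length a b (suc (suc c)) xs)
    where
    pending≡ : replicate c b ++ x ∷ xs ≡ b ∷ replicate c b ++ xs
    pending≡ = trans (cong (λ y → replicate c b ++ y ∷ xs) (≡ᵇ-true⇒≡ eq)) (replicate-++-∷ c b xs)
  ... | false = begin
    count a (b ∷ R ++ x ∷ xs) + suc D     ≤⟨ +-monoˡ-≤ (suc D) (count-pair≤ a R xs b≢x) ⟩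
    suc (count a (R ++ xs)) + suc D       ≡⟨ cong suc (+-suc _ D) ⟩
    suc (suc (count a (R ++ xs) + D))     ≤⟨ s≤s (s≤s (count+decrements≤length a b c xs)) ⟩
    suc (suc (length (R ++ xs)))          ≡⟨ cong suc (sym (length-++-sucʳ R x xs)) ⟩
    suc (length (R ++ x ∷ xs))            ∎
    where
    open ≤-Reasoning
    R : List Item
    R = replicate c b
    D : ℕ
    D = decrements b c xs
    b≢x : b ≢ x
    b≢x b≡x = ≡ᵇ-false⇒≢ eq (sym b≡x)

  weight≤weight-majGo+decrements*K : ∀ {w K} b c xs → All (λ y → 1 ≤ w y) (b ∷ xs) → (∀ a → w a ≤ suc K) →
    weight w xs ≤ weight w (majGo b c xs) + decrements b c xs * K
  weight≤weight-majGo+decrements*K b c [] _ _ = z≤n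
  weight≤weight-majGo+decrements*K {w} b zero (x ∷ xs) (_ ∷ pos) bound =
    ≤-trans (+-monoʳ-≤ (w x) (weight≤weight-majGo+decrements*K x 1 xs pos bound))
            (≤-reflexive (sym (+-assoc (w x) _ _)))
  weight≤weight-majGo+decrements*K {w} {K} b (suc c) (x ∷ xs) (1≤wb ∷ _ ∷ pos) bound with x ≡ᵇ b in eq
  ... | true =
    ≤-trans (+-mono-≤ (≤-reflexive (cong w (≡ᵇ-true⇒≡ eq)))
                      (weight≤weight-majGo+decrements*K b (suc (suc c)) xs (1≤wb ∷ pos) bound))
            (≤-reflexive (sym (+-assoc (w b) _ _)))
  ... | false = ≤-trans (+-mono-≤ wx≤wb+K (weight≤weight-majGo+decrements*K b c xs (1≤wb ∷ pos) bound))
                        (≤-reflexive (interchange (w b) K _ _))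
    where
    wx≤wb+K : w x ≤ w b + K
    wx≤wb+K = ≤-trans (bound x) (+-monoˡ-≤ K 1≤wb)

  -- Maj I is definitionally majGo x 0 I for I = x ∷ xs, which lets the first item serve as buffer.
  Nai≤Maj+quarterSquare : ∀ {k} I → length I ≡ suc k → totalCount Nai I ≤ totalCount Maj I + quarterSquare k
  Nai≤Maj+quarterSquare {k} I@(x ∷ xs) refl =
    ≤-trans (weight≤weight-majGo+decrements*K x 0 I (1≤wx ∷ mult-positive I) w≤1+K)
            (+-monoʳ-≤ _ (subst (λ n → D * K ≤ quarterSquare n) D+K≡k (m*n≤quarterSquare[m+n] D K)))
    where
    w : Item → ℕ
    w = mult I
    1≤wx : 1 ≤ w x
    1≤wx = ∈⇒1≤count {xs = I} (here refl)
    D : ℕ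
    D = decrements x 0 I
    w+D≤1+k : ∀ a → w a + D ≤ suc k
    w+D≤1+k a = count+decrements≤length a x 0 I
    D≤k : D ≤ k
    D≤k = ≤-pred (≤-trans (+-monoˡ-≤ D 1≤wx) (w+D≤1+k x))
    K : ℕ
    K = proj₁ (m≤n⇒∃[o]m+o≡n D≤k)
    D+K≡k : D + K ≡ k
    D+K≡k = proj₂ (m≤n⇒∃[o]m+o≡n D≤k)
    w≤1+K : ∀ a → w a ≤ suc K
    w≤1+K a = +-cancelʳ-≤ D (w a) (suc K)
                (≤-trans (w+D≤1+k a) (≤-reflexive (cong suc (trans (sym D+K≡k) (+-comm D K)))))

  -- Extremal inputs

  distinct : ℕ → List Item
  distinct zero    = []
  distinct (suc m) = suc m ∷ distinct m

  alternating : ℕ → List Item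
  alternating zero    = []
  alternating (suc m) = suc m ∷ 0 ∷ alternating m

  doubled : ℕ → List Item
  doubled zero    = []
  doubled (suc m) = suc m ∷ suc m ∷ doubled m

  All-distinct : ∀ {P : Item → Set} m → (∀ j → P (suc j)) → All P (distinct m)
  All-distinct zero    p = []
  All-distinct (suc m) p = p m ∷ All-distinct m p

  All-doubled : ∀ {P : Item → Set} m → (∀ j → P (suc j)) → All P (doubled m)
  All-doubled zero    p = []
  All-doubled (suc m) p = p m ∷ p m ∷ All-doubled m p

  length-distinct : ∀ m → length (distinct m) ≡ m
  length-distinct zero    = refl
  length-distinct (suc m) = cong suc (length-distinct m)

  length-doubled : ∀ m → length (doubled m) ≡ m + m
  length-doubled zero    = refl
  length-doubled (suc m) = cong suc (trans (cong suc (length-doubled m)) (sym (+-suc m m)))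

  length-alternating : ∀ m → length (alternating m) ≡ m + m
  length-alternating zero    = refl
  length-alternating (suc m) = cong suc (trans (cong suc (length-alternating m)) (sym (+-suc m m)))

  count-distinct-0 : ∀ m → count 0 (distinct m) ≡ 0
  count-distinct-0 zero    = refl
  count-distinct-0 (suc m) = count-distinct-0 m

  count-distinct-> : ∀ {a} m → m < a → count a (distinct m) ≡ 0
  count-distinct-> zero    _   = refl
  count-distinct-> (suc m) m<a =
    trans (count-there (distinct m) (<⇒≢ m<a)) (count-distinct-> m (<-trans (n<1+n m) m<a))

  count-distinct≤1 : ∀ a m → count a (distinct m) ≤ 1
  count-distinct≤1 a zero    = z≤n
  count-distinct≤1 a (suc m) with suc m ≟ a
  ... | yes refl = ≤-reflexive (trans (count-here (suc m) (distinct m)) (cong suc (count-distinct-> m ≤-refl)))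
  ... | no  m≢a  = ≤-trans (≤-reflexive (count-there (distinct m) m≢a)) (count-distinct≤1 a m)

  count-alternating-0 : ∀ m → count 0 (alternating m) ≡ m
  count-alternating-0 zero    = refl
  count-alternating-0 (suc m) = cong suc (count-alternating-0 m)

  count-alternating-suc : ∀ j m → count (suc j) (alternating m) ≡ count (suc j) (distinct m)
  count-alternating-suc j zero    = refl
  count-alternating-suc j (suc m) with m ≡ᵇ j
  ... | true  = cong suc (count-alternating-suc j m)
  ... | false = count-alternating-suc j m

  majGo-replicate : ∀ r c L → majGo 0 (suc c) (replicate r 0 ++ L) ≡ replicate r 0 ++ majGo 0 (suc (r + c)) L
  majGo-replicate zero    c L = refl
  majGo-replicate (suc r) c L = cong (0 ∷_) (trans (majGo-replicate r (suc c) L)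
                                                   (cong (λ n → replicate r 0 ++ majGo 0 (suc n) L) (+-suc r c)))

  majGo-distinct : ∀ m c → m ≤ c → majGo 0 c (distinct m) ≡ replicate m 0
  majGo-distinct zero    c       _         = refl
  majGo-distinct (suc m) (suc c) (s≤s m≤c) = cong (0 ∷_) (majGo-distinct m c m≤c)

  majGo-alternating : ∀ b m x L → majGo b 0 (alternating m ++ x ∷ L) ≡ doubled m ++ majGo x 0 (x ∷ L)
  majGo-alternating b zero    x L = refl
  majGo-alternating b (suc m) x L = cong (λ M → suc m ∷ suc m ∷ M) (majGo-alternating (suc m) m x L)

  runThenDistinct : ℕ → ℕ → List Item
  runThenDistinct l h = replicate (suc l) 0 ++ distinct h

  length-runThenDistinct : ∀ l h → length (runThenDistinct l h) ≡ suc (l + h)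
  length-runThenDistinct l h =
    trans (length-++ (replicate (suc l) 0)) (cong₂ _+_ (length-replicate (suc l)) (length-distinct h))

  Maj-runThenDistinct : ∀ l h → h ≤ suc l → Maj (runThenDistinct l h) ≡ 0 ∷ replicate l 0 ++ replicate h 0
  Maj-runThenDistinct l h h≤1+l = cong (0 ∷_) (trans (majGo-replicate l 0 (distinct h))
    (cong (replicate l 0 ++_) (majGo-distinct h (suc (l + 0)) (subst (λ n → h ≤ suc n) (sym (+-identityʳ l)) h≤1+l))))

  Nai+l*h≤Maj[runThenDistinct] : ∀ l h → h ≤ suc l →
    totalCount Nai (runThenDistinct l h) + l * h ≤ totalCount Maj (runThenDistinct l h)
  Nai+l*h≤Maj[runThenDistinct] l h h≤1+l = begin
    weight w I + l * h
      ≡⟨ cong (_+ l * h) (weight-++ w (replicate (suc l) 0) (distinct h)) ⟩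
    weight w (replicate (suc l) 0) + weight w (distinct h) + l * h
      ≤⟨ +-monoˡ-≤ (l * h) (+-mono-≤ (≤-reflexive (weight-replicate w (suc l) 0)) rare) ⟩
    suc l * w 0 + h * 1 + l * h
      ≡⟨ cong (λ v → suc l * v + h * 1 + l * h) w0≡1+l ⟩
    suc l * suc l + h * 1 + l * h
      ≡⟨ regroup l h ⟩
    suc l + (l * suc l + h * suc l)
      ≡⟨ cong (λ v → v + (l * v + h * v)) (sym w0≡1+l) ⟩
    w 0 + (l * w 0 + h * w 0)
      ≡⟨ cong (λ v → w 0 + v) (sym weight-zeros) ⟩
    weight w (0 ∷ replicate l 0 ++ replicate h 0)
      ≡⟨ cong (weight w) (sym (Maj-runThenDistinct l h h≤1+l)) ⟩
    weight w (Maj I)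
      ∎
    where
    open ≤-Reasoning
    I : List Item
    I = runThenDistinct l h
    w : Item → ℕ
    w = mult I
    regroup : ∀ l h → suc l * suc l + h * 1 + l * h ≡ suc l + (l * suc l + h * suc l)
    regroup = solve-∀
    w0≡1+l : w 0 ≡ suc l
    w0≡1+l = trans (count-++ 0 (replicate (suc l) 0) (distinct h))
                   (trans (cong₂ _+_ (count-replicate 0 (suc l)) (count-distinct-0 h)) (+-identityʳ (suc l)))
    rare≤1 : ∀ j → w (suc j) ≤ 1
    rare≤1 j = ≤-trans (≤-reflexive (trans (count-++ (suc j) (replicate (suc l) 0) (distinct h))
                                           (cong (_+ count (suc j) (distinct h)) zeros)))
                       (count-distinct≤1 (suc j) h)
      where
      zeros : count (suc j) (replicate (suc l) 0) ≡ 0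
      zeros = count-replicate-≢ {0} {suc j} (suc l) λ ()
    rare : weight w (distinct h) ≤ h * 1
    rare = subst (λ n → weight w (distinct h) ≤ n * 1) (length-distinct h)
                 (weight≤length* (distinct h) (All-distinct h rare≤1))
    weight-zeros : weight w (replicate l 0 ++ replicate h 0) ≡ l * w 0 + h * w 0
    weight-zeros = trans (weight-++ w (replicate l 0) (replicate h 0))
                         (cong₂ _+_ (weight-replicate w l 0) (weight-replicate w h 0))

  alternatingThenRun : ℕ → ℕ → List Item
  alternatingThenRun l e = alternating l ++ replicate (suc e) 0

  length-alternatingThenRun : ∀ l e → length (alternatingThenRun l e) ≡ (l + l) + suc e
  length-alternatingThenRun l e =
    trans (length-++ (alternating l)) (cong₂ _+_ (length-alternating l) (length-replicate (suc e)))

  Maj-alternatingThenRun : ∀ l e → Maj (alternatingThenRun l e) ≡ doubled l ++ replicate (suc e) 0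
  Maj-alternatingThenRun l e = trans (majGo-alternating 0 l 0 (replicate e 0))
    (cong (λ M → doubled l ++ 0 ∷ M) (trans (cong (majGo 0 1) (sym (++-identityʳ (replicate e 0))))
                                            (trans (majGo-replicate e 0 []) (++-identityʳ (replicate e 0)))))

  Maj+l*[l+e]≤Nai[alternatingThenRun] : ∀ l e →
    totalCount Maj (alternatingThenRun l e) + l * (l + e) ≤ totalCount Nai (alternatingThenRun l e)
  Maj+l*[l+e]≤Nai[alternatingThenRun] l e = +-cancelʳ-≤ (w 0) _ _ (begin
    weight w (Maj I) + l * (l + e) + w 0
      ≡⟨ cong (λ M → weight w M + l * (l + e) + w 0) (Maj-alternatingThenRun l e) ⟩
    weight w (doubled l ++ replicate (suc e) 0) + l * (l + e) + w 0
      ≡⟨ cong (λ v → v + l * (l + e) + w 0) (weight-++ w (doubled l) (replicate (suc e) 0)) ⟩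
    weight w (doubled l) + weight w (replicate (suc e) 0) + l * (l + e) + w 0
      ≤⟨ +-monoˡ-≤ (w 0) (+-monoˡ-≤ (l * (l + e)) (+-mono-≤ rare (≤-reflexive (weight-replicate w (suc e) 0)))) ⟩
    (l + l) * 1 + suc e * w 0 + l * (l + e) + w 0
      ≡⟨ cong (λ v → (l + l) * 1 + suc e * v + l * (l + e) + v) w0≡ ⟩
    (l + l) * 1 + suc e * (l + suc e) + l * (l + e) + (l + suc e)
      ≡⟨ regroup l e ⟩
    (l + suc e) * (l + suc e) + ((l + l) + suc e)
      ≡⟨ cong₂ (λ v n → v * v + n) (sym w0≡) (sym (length-alternatingThenRun l e)) ⟩
    w 0 * w 0 + length I
      ≤⟨ count*+length≤weight+count w 0 I (mult-positive I) ⟩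
    weight w I + w 0
      ∎)
    where
    open ≤-Reasoning
    I : List Item
    I = alternatingThenRun l e
    w : Item → ℕ
    w = mult I
    regroup : ∀ l e → (l + l) * 1 + suc e * (l + suc e) + l * (l + e) + (l + suc e)
                      ≡ (l + suc e) * (l + suc e) + ((l + l) + suc e)
    regroup = solve-∀
    w0≡ : w 0 ≡ l + suc e
    w0≡ = trans (count-++ 0 (alternating l) (replicate (suc e) 0))
                (cong₂ _+_ (count-alternating-0 l) (count-replicate 0 (suc e)))
    rare≤1 : ∀ j → w (suc j) ≤ 1
    rare≤1 j = ≤-trans (≤-reflexive (trans (count-++ (suc j) (alternating l) (replicate (suc e) 0))
                                           (trans (cong₂ _+_ (count-alternating-suc j l) zeros) (+-identityʳ _))))
                       (count-distinct≤1 (suc j) l)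
      where
      zeros : count (suc j) (replicate (suc e) 0) ≡ 0
      zeros = count-replicate-≢ {0} {suc j} (suc e) λ ()
    rare : weight w (doubled l) ≤ (l + l) * 1
    rare = subst (λ n → weight w (doubled l) ≤ n * 1) (length-doubled l)
                 (weight≤length* (doubled l) (All-doubled l rare≤1))

  Maj-excess-attained : ∀ k → ∃[ I ] (length I ≡ suc k × totalCount Maj I ≡ totalCount Nai I + quarterSquare k)
  Maj-excess-attained k = I , |I| , ≤-antisym (Maj≤Nai+quarterSquare I |I|)
                                              (Nai+l*h≤Maj[runThenDistinct] ⌊ k /2⌋ ⌈ k /2⌉ (⌈n/2⌉≤1+⌊n/2⌋ k))
    where
    I : List Item
    I = runThenDistinct ⌊ k /2⌋ ⌈ k /2⌉
    |I| : length I ≡ suc k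
    |I| = trans (length-runThenDistinct ⌊ k /2⌋ ⌈ k /2⌉) (cong suc (⌊n/2⌋+⌈n/2⌉≡n k))

  Nai-excess-attained : ∀ k → ∃[ I ] (length I ≡ suc k × totalCount Nai I ≡ totalCount Maj I + quarterSquare k)
  Nai-excess-attained k = I , |I| , ≤-antisym (Nai≤Maj+quarterSquare I |I|)
    (subst (λ q → totalCount Maj I + q ≤ totalCount Nai I) l*[l+e]≡ (Maj+l*[l+e]≤Nai[alternatingThenRun] l e))
    where
    l e : ℕ
    l = ⌊ k /2⌋
    e = proj₁ (m≤n⇒∃[o]m+o≡n (⌊n/2⌋≤⌈n/2⌉ k))
    l+e≡h : l + e ≡ ⌈ k /2⌉
    l+e≡h = proj₂ (m≤n⇒∃[o]m+o≡n (⌊n/2⌋≤⌈n/2⌉ k))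
    I : List Item
    I = alternatingThenRun l e
    l*[l+e]≡ : l * (l + e) ≡ quarterSquare k
    l*[l+e]≡ = cong (l *_) l+e≡h
    |I| : length I ≡ suc k
    |I| = trans (length-alternatingThenRun l e) (trans (+-suc (l + l) e)
            (cong suc (trans (+-assoc l l e) (trans (cong (λ v → l + v) l+e≡h) (⌊n/2⌋+⌈n/2⌉≡n k)))))

open Counting
  using ( quarterSquare; 4*quarterSquare≤n*[1+n]; quarterSquare-n+n; mult; weight; totalCount
        ; Maj≤Nai+quarterSquare; Nai≤Maj+quarterSquare; Maj-excess-attained; Nai-excess-attained)

open import Data.Nat as ℕ using (ℕ; zero; suc)
import Data.Nat.Properties as ℕ
open import Data.Nat.Tactic.RingSolver using (solve-∀)
open import Data.Integer as ℤ using (+[1+_]; +0; -[1+_]; +<+)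
import Data.Integer.Properties as ℤ
open import Data.Rational using (ℚ; mkℚ; 0ℚ; _+_; _-_; _*_; _<_; _≤_; toℚᵘ; *<*)
open import Data.Rational.Properties
open import Data.Rational.Unnormalised as ℚᵘ using (mkℚᵘ; *≡*; *≤*)
import Data.Rational.Unnormalised.Properties as ℚᵘ
open import Algebra.Properties.AbelianGroup +-0-abelianGroup using (xyx⁻¹≈y; ⁻¹-anti-homo‿-; ⁻¹-involutive)
open import Data.List using ([]; _∷_; length; map)
open import Data.Product using (_,_; ∃-syntax)
open import Relation.Binary.PropositionalEquality

-- Fractions with a positive natural denominator

toℚᵘ-/ : ∀ a m → toℚᵘ (+ a / suc m) ℚᵘ.≃ mkℚᵘ (+ a) m
toℚᵘ-/ a m = toℚᵘ-fromℚᵘ (mkℚᵘ (+ a) m)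

/-≡ : ∀ a m b n → a ℕ.* suc n ≡ b ℕ.* suc m → + a / suc m ≡ + b / suc n
/-≡ a m b n eq = toℚᵘ-injective
  (ℚᵘ.≃-trans (toℚᵘ-/ a m) (ℚᵘ.≃-trans (*≡* cross) (ℚᵘ.≃-sym (toℚᵘ-/ b n))))
  where
  cross : + a ℤ.* + suc n ≡ + b ℤ.* + suc m
  cross = trans (sym (ℤ.pos-* a (suc n))) (trans (cong +_ eq) (ℤ.pos-* b (suc m)))

/-≤ : ∀ a m b n → a ℕ.* suc n ℕ.≤ b ℕ.* suc m → + a / suc m ≤ + b / suc n
/-≤ a m b n le = toℚᵘ-cancel-≤
  (ℚᵘ.≤-respʳ-≃ (ℚᵘ.≃-sym (toℚᵘ-/ b n)) (ℚᵘ.≤-respˡ-≃ (ℚᵘ.≃-sym (toℚᵘ-/ a m))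
    (*≤* (subst₂ ℤ._≤_ (ℤ.pos-* a (suc n)) (ℤ.pos-* b (suc m)) (ℤ.+≤+ le)))))

/-< : ∀ a m b n → a ℕ.* suc n ℕ.< b ℕ.* suc m → + a / suc m < + b / suc n
/-< a m b n lt = toℚᵘ-cancel-<
  (ℚᵘ.<-respʳ-≃ (ℚᵘ.≃-sym (toℚᵘ-/ b n)) (ℚᵘ.<-respˡ-≃ (ℚᵘ.≃-sym (toℚᵘ-/ a m))
    (ℚᵘ.*<* (subst₂ ℤ._<_ (ℤ.pos-* a (suc n)) (ℤ.pos-* b (suc m)) (+<+ lt)))))

/-+ : ∀ a m b n → + a / suc m + + b / suc n ≡ + (a ℕ.* suc n ℕ.+ b ℕ.* suc m) / (suc m ℕ.* suc n)
/-+ a m b n = toℚᵘ-injective (ℚᵘ.≃-trans (toℚᵘ-homo-+ (+ a / suc m) (+ b / suc n))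
  (ℚᵘ.≃-trans (ℚᵘ.+-cong (toℚᵘ-/ a m) (toℚᵘ-/ b n))
  (ℚᵘ.≃-trans (ℚᵘ.≃-reflexive (cong (λ z → mkℚᵘ z (n ℕ.+ m ℕ.* suc n)) numerator))
  (ℚᵘ.≃-sym (toℚᵘ-/ (a ℕ.* suc n ℕ.+ b ℕ.* suc m) (n ℕ.+ m ℕ.* suc n))))))
  where
  numerator : + a ℤ.* + suc n ℤ.+ + b ℤ.* + suc m ≡ + (a ℕ.* suc n ℕ.+ b ℕ.* suc m)
  numerator = trans (cong₂ ℤ._+_ (sym (ℤ.pos-* a (suc n))) (sym (ℤ.pos-* b (suc m))))
                    (sym (ℤ.pos-+ (a ℕ.* suc n) (b ℕ.* suc m)))

/-* : ∀ a m b n → + a / suc m * (+ b / suc n) ≡ + (a ℕ.* b) / (suc m ℕ.* suc n)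
/-* a m b n = toℚᵘ-injective (ℚᵘ.≃-trans (toℚᵘ-homo-* (+ a / suc m) (+ b / suc n))
  (ℚᵘ.≃-trans (ℚᵘ.*-cong (toℚᵘ-/ a m) (toℚᵘ-/ b n))
  (ℚᵘ.≃-trans (ℚᵘ.≃-reflexive (cong (λ z → mkℚᵘ z (n ℕ.+ m ℕ.* suc n)) (sym (ℤ.pos-* a b))))
  (ℚᵘ.≃-sym (toℚᵘ-/ (a ℕ.* b) (n ℕ.+ m ℕ.* suc n))))))

/-+-same : ∀ a b m → + a / suc m + + b / suc m ≡ + (a ℕ.+ b) / suc m
/-+-same a b m =
  trans (/-+ a m b m) (/-≡ (a ℕ.* suc m ℕ.+ b ℕ.* suc m) (m ℕ.+ m ℕ.* suc m) (a ℕ.+ b) m (regroup a b m))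
  where
  regroup : ∀ a b m → (a ℕ.* suc m ℕ.+ b ℕ.* suc m) ℕ.* suc m ≡ (a ℕ.+ b) ℕ.* (suc m ℕ.* suc m)
  regroup = solve-∀

p≤q+r⇒p-q≤r : ∀ {p} q r → p ≤ q + r → p - q ≤ r
p≤q+r⇒p-q≤r q r p≤q+r = ≤-trans (+-monoˡ-≤ (- q) p≤q+r) (≤-reflexive (xyx⁻¹≈y q r))

p<q+r⇒p-r<q : ∀ {p} q r → p < q + r → p - r < q
p<q+r⇒p-r<q q r p<q+r =
  <-≤-trans (+-monoˡ-< (- r) p<q+r) (≤-reflexive (trans (cong (_- r) (+-comm q r)) (xyx⁻¹≈y r q)))

sub-/-≤ : ∀ {a} b c m → a ℕ.≤ b ℕ.+ c → + a / suc m - + b / suc m ≤ + c / suc m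
sub-/-≤ {a} b c m a≤b+c = p≤q+r⇒p-q≤r _ _
  (≤-trans (/-≤ a m (b ℕ.+ c) m (ℕ.*-monoˡ-≤ (suc m) a≤b+c)) (≤-reflexive (sym (/-+-same b c m))))

sub-/-≡ : ∀ {a} b c m → a ≡ b ℕ.+ c → + a / suc m - + b / suc m ≡ + c / suc m
sub-/-≡ b c m refl =
  trans (cong (_- + b / suc m) (sym (/-+-same b c m))) (xyx⁻¹≈y (+ b / suc m) (+ c / suc m))

sub-/-≥ : ∀ {a} b c m → b ℕ.≤ a ℕ.+ c → - (+ c / suc m) ≤ + a / suc m - + b / suc m
sub-/-≥ {a} b c m b≤a+c = ≤-trans (neg-antimono-≤ (sub-/-≤ a c m b≤a+c))
                                  (≤-reflexive (⁻¹-anti-homo‿- (+ b / suc m) (+ a / suc m)))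

sub-/-≡-neg : ∀ {a} b c m → b ≡ a ℕ.+ c → + a / suc m - + b / suc m ≡ - (+ c / suc m)
sub-/-≡-neg {a} b c m b≡a+c = trans (sym (⁻¹-anti-homo‿- (+ b / suc m) (+ a / suc m)))
                                    (cong -_ (sub-/-≡ a c m b≡a+c))

positive-form : ∀ ε → 0ℚ < ε → ∃[ p ] ∃[ q ] (ε ≡ + suc p / suc q)
positive-form ε@(mkℚ +[1+ p ] q _) _ = p , q , sym (↥p/↧p≡p ε)
positive-form (mkℚ +0       _ _) (*<* (+<+ ()))
positive-form (mkℚ -[1+ _ ] _ _) (*<* ())

limSup-intro : ∀ {a : ℕ → ℚ} {L} → (∀ n → a n ≤ L) →
               (∀ ε → 0ℚ < ε → ∀ N → ∃[ n ] (N ℕ.≤ n × L - ε < a n)) → LimSupIs a L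
limSup-intro {L = L} bounded approached ε ε>0 = (0 , λ n _ → ≤-<-trans (bounded n) L<L+ε) , approached ε ε>0
  where
  L<L+ε : L < L + ε
  L<L+ε = subst (_< L + ε) (+-identityʳ L) (+-monoʳ-< L ε>0)

limInf-neg : ∀ {a b : ℕ → ℚ} {L} → (∀ n → b n ≡ - a n) → LimSupIs a L → LimInfIs b (- L)
limInf-neg {a} {b} {L} b≡-a limSup ε ε>0 with limSup ε ε>0
... | (N , eventually) , frequently = (N , eventually′) , frequently′
  where
  eventually′ : ∀ n → N ℕ.≤ n → - L - ε < b n
  eventually′ n N≤n = subst₂ _<_ (neg-distrib-+ L ε) (sym (b≡-a n)) (neg-antimono-< (eventually n N≤n))
  frequently′ : ∀ M → ∃[ n ] (M ℕ.≤ n × b n < - L + ε)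
  frequently′ M with frequently M
  ... | n , M≤n , L-ε<an = n , M≤n , subst₂ _<_ (sym (b≡-a n)) neg[L-ε] (neg-antimono-< L-ε<an)
    where
    neg[L-ε] : - (L - ε) ≡ - L + ε
    neg[L-ε] = trans (neg-distrib-+ L (- ε)) (cong (λ x → - L + x) (⁻¹-involutive ε))

÷ℕ-neg : ∀ q n → (- q) ÷ℕ n ≡ - (q ÷ℕ n)
÷ℕ-neg q zero    = refl
÷ℕ-neg q (suc k) = sym (neg-distribˡ-* q (+ 1 / suc k))

freq-≡ : ∀ {k} I a → length I ≡ suc k → freq I a ≡ + count a I / suc k
freq-≡ {k} I a |I| = begin
  (+ c / 1) ÷ℕ length I        ≡⟨ cong ((+ c / 1) ÷ℕ_) |I| ⟩
  + c / 1 * (+ 1 / suc k)      ≡⟨ /-* c 0 1 k ⟩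
  + (c ℕ.* 1) / (1 ℕ.* suc k)  ≡⟨ /-≡ (c ℕ.* 1) (k ℕ.+ 0 ℕ.* suc k) c k (drop-units c k) ⟩
  + c / suc k                  ∎
  where
  open ≡-Reasoning
  c : ℕ
  c = count a I
  drop-units : ∀ c k → c ℕ.* 1 ℕ.* suc k ≡ c ℕ.* suc (k ℕ.+ 0 ℕ.* suc k)
  drop-units = solve-∀

agg-≡ : ∀ {k} A I → length I ≡ suc k → agg A I ≡ + weight (mult I) (A I) / suc k
agg-≡ {k} A I |I| = go (A I)
  where
  go : ∀ L → sumℚ (map (freq I) L) ≡ + weight (mult I) L / suc k
  go []      = sym (0/n≡0 (suc k))
  go (x ∷ L) = trans (cong₂ _+_ (freq-≡ I x |I|) (go L)) (/-+-same (count x I) (weight (mult I) L) k)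

diff-≡ : ∀ {k} I → length I ≡ suc k →
         diff Nai Maj I ≡ + totalCount Nai I / suc k - + totalCount Maj I / suc k
diff-≡ I |I| = cong₂ _-_ (agg-≡ Nai I |I|) (agg-≡ Maj I |I|)

-- The value at n = 0 is never constrained: IsMinDiff and IsMaxDiff are only required for n ≥ 1.
maxDiff : ℕ → ℚ
maxDiff zero    = 0ℚ
maxDiff (suc k) = + quarterSquare k / suc k

minDiff : ℕ → ℚ
minDiff n = - maxDiff n

isMaxDiff : ∀ n → 1 ℕ.≤ n → IsMaxDiff Nai Maj n (maxDiff n)
isMaxDiff (suc k) _ with Nai-excess-attained k
... | I , |I| , excess =
  (I , |I| , trans (diff-≡ I |I|) (sub-/-≡ (totalCount Maj I) (quarterSquare k) k excess)) , bound
  where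
  bound : ∀ I → length I ≡ suc k → diff Nai Maj I ≤ maxDiff (suc k)
  bound I |I| = ≤-trans (≤-reflexive (diff-≡ I |I|))
                        (sub-/-≤ (totalCount Maj I) (quarterSquare k) k (Nai≤Maj+quarterSquare I |I|))

isMinDiff : ∀ n → 1 ℕ.≤ n → IsMinDiff Nai Maj n (minDiff n)
isMinDiff (suc k) _ with Maj-excess-attained k
... | I , |I| , excess =
  (I , |I| , trans (diff-≡ I |I|) (sub-/-≡-neg (totalCount Maj I) (quarterSquare k) k excess)) , bound
  where
  bound : ∀ I → length I ≡ suc k → minDiff (suc k) ≤ diff Nai Maj I
  bound I |I| = ≤-trans (sub-/-≥ (totalCount Maj I) (quarterSquare k) k (Maj≤Nai+quarterSquare I |I|))
                        (≤-reflexive (sym (diff-≡ I |I|)))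

maxDiff÷ℕ : ∀ k → maxDiff (suc k) ÷ℕ suc k ≡ + quarterSquare k / (suc k ℕ.* suc k)
maxDiff÷ℕ k = trans (/-* (quarterSquare k) k 1 k)
                    (cong (λ x → + x / (suc k ℕ.* suc k)) (ℕ.*-identityʳ (quarterSquare k)))

maxDiff÷ℕ≤1/4 : ∀ n → maxDiff n ÷ℕ n ≤ + 1 / 4
maxDiff÷ℕ≤1/4 zero    = /-≤ 0 0 1 3 ℕ.z≤n
maxDiff÷ℕ≤1/4 (suc k) = ≤-trans (≤-reflexive (maxDiff÷ℕ k)) (/-≤ (quarterSquare k) (k ℕ.+ k ℕ.* suc k) 1 3 (begin
  quarterSquare k ℕ.* 4     ≡⟨ ℕ.*-comm (quarterSquare k) 4 ⟩
  4 ℕ.* quarterSquare k     ≤⟨ 4*quarterSquare≤n*[1+n] k ⟩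
  k ℕ.* suc k               ≤⟨ ℕ.*-monoˡ-≤ (suc k) (ℕ.n≤1+n k) ⟩
  suc k ℕ.* suc k           ≡⟨ sym (ℕ.*-identityˡ _) ⟩
  1 ℕ.* (suc k ℕ.* suc k)   ∎))
  where open ℕ.≤-Reasoning

1/4<j²/[2j+1]²+1/[1+j] : ∀ j → + 1 / 4 < + (j ℕ.* j) / (suc (j ℕ.+ j) ℕ.* suc (j ℕ.+ j)) + + 1 / suc j
1/4<j²/[2j+1]²+1/[1+j] j = subst (+ 1 / 4 <_) (sym (/-+ (j ℕ.* j) d 1 j))
  (/-< 1 3 (j ℕ.* j ℕ.* suc j ℕ.+ 1 ℕ.* suc d) (j ℕ.+ d ℕ.* suc j)
       (ℕ.≤-trans (ℕ.m≤m+n _ (12 ℕ.* j ℕ.* j ℕ.+ 11 ℕ.* j ℕ.+ 2)) (ℕ.≤-reflexive (expand j))))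
  where
  d : ℕ
  d = (j ℕ.+ j) ℕ.+ (j ℕ.+ j) ℕ.* suc (j ℕ.+ j)
  expand : ∀ j → suc (1 ℕ.* (suc (j ℕ.+ j) ℕ.* suc (j ℕ.+ j) ℕ.* suc j)) ℕ.+ (12 ℕ.* j ℕ.* j ℕ.+ 11 ℕ.* j ℕ.+ 2)
                 ≡ (j ℕ.* j ℕ.* suc j ℕ.+ 1 ℕ.* (suc (j ℕ.+ j) ℕ.* suc (j ℕ.+ j))) ℕ.* 4
  expand = solve-∀

maxDiff÷ℕ-approaches : ∀ ε → 0ℚ < ε → ∀ N → ∃[ n ] (N ℕ.≤ n × + 1 / 4 - ε < maxDiff n ÷ℕ n)
maxDiff÷ℕ-approaches ε ε>0 N with positive-form ε ε>0
... | p , q , refl = suc (j ℕ.+ j) , N≤n ,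
  p<q+r⇒p-r<q _ _ (<-≤-trans (1/4<j²/[2j+1]²+1/[1+j] j) (+-mono-≤ (≤-reflexive (sym value)) 1/[1+j]≤ε))
  where
  j : ℕ
  j = N ℕ.+ q
  N≤n : N ℕ.≤ suc (j ℕ.+ j)
  N≤n = ℕ.≤-trans (ℕ.m≤m+n N q) (ℕ.≤-trans (ℕ.m≤m+n j j) (ℕ.n≤1+n _))
  value : maxDiff (suc (j ℕ.+ j)) ÷ℕ suc (j ℕ.+ j) ≡ + (j ℕ.* j) / (suc (j ℕ.+ j) ℕ.* suc (j ℕ.+ j))
  value = trans (maxDiff÷ℕ (j ℕ.+ j)) (cong (λ x → + x / (suc (j ℕ.+ j) ℕ.* suc (j ℕ.+ j))) (quarterSquare-n+n j))
  1/[1+j]≤ε : + 1 / suc j ≤ + suc p / suc q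
  1/[1+j]≤ε = /-≤ 1 j (suc p) q (ℕ.≤-trans (ℕ.≤-reflexive (ℕ.*-identityˡ (suc q)))
                                  (ℕ.≤-trans (ℕ.s≤s (ℕ.m≤n+m q N)) (ℕ.m≤n*m (suc j) (suc p))))

maxDiff-limSup : LimSupIs (λ n → maxDiff n ÷ℕ n) (+ 1 / 4)
maxDiff-limSup = limSup-intro maxDiff÷ℕ≤1/4 maxDiff÷ℕ-approaches

theorem6 : MinIs Nai Maj (- (+ 1 / 4)) × MaxIs Nai Maj (+ 1 / 4)
theorem6 = (minDiff , isMinDiff , limInf-neg {L = + 1 / 4} (λ n → ÷ℕ-neg (maxDiff n) n) maxDiff-limSup)
         , (maxDiff , isMaxDiff , maxDiff-limSup)
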